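{- Let $T=2^\ell$ and let jobs $j$ have integer release dates $r_j\in[0,T)$, with $\mathrm{Seg}(j)$ and job-segments defined as below. Let $\prec_J$ be a total order of the jobs by release date (ties broken arbitrarily), and let $\mathcal{T}$ be the forest defined below on the set of all job-segments. For integers $0\le s\le t\le T$ and $I=[s,t]$, let $V_I$ be the set of job-segments $(j,S)$ such that $r_j\in[s,t]$ and $[t,t+1]\subseteq S$. Then the vertices of $V_I$ form a path in $\mathcal{T}$ from an ancestor to a descendant.
   Context: Dyadic segments: for $s=0,\dots,\ell$, $\mathcal{S}_s=\{[i2^s,(i+1)2^s]: 0\le i<T/2^s\}$. For each job $j$, $\mathrm{Seg}(j)$ is produced by: $t\leftarrow r_j$; for $s=0,1,2,\dots$ until $t=T$: if $t$ is a multiple of $2^{s+1}$, append $[t,t+2^s]$ and $[t+2^s,t+2^{s+1}]$ (segments of $\mathcal{S}_s$) and set $t\leftarrow t+2^{s+1}$; otherwise append $[t,t+2^s]$ and set $t\leftarrow t+2^s$. The segments of $\mathrm{Seg}(j)$ partition $[r_j,T]$. A job-segment is a pair $(j,S)$ with $S\in\mathrm{Seg}(j)$. Forest $\mathcal{T}$: its vertices are all job-segments; for a job-segment $(j,S)$ where $j$ is not the first job in $\prec_J$, let $j'$ be the job immediately preceding $j$ in $\prec_J$; its parent is the job-segment $(j',S')$ where $S'\in\mathrm{Seg}(j')$ is the segment containing $S$ (such a segment exists and is unique since segments of $\mathrm{Seg}(j')$ intersecting $S$ contain it). Job-segments of the first job in $\prec_J$ are roots. (The paper additionally attaches a new root above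 each tree; this does not affect the statement.) -}

module Defs where

open import Data.Nat using (ℕ; zero; suc; _+_; _^_; _≤_; _<_)
open import Data.Nat.Divisibility using (_∣?_)
open import Data.Fin using (Fin; toℕ)
import Data.Fin as F
open import Data.Product using (_×_; _,_; Σ; ∃)
open import Data.List using (List; []; _∷_)
open import Data.List.Membership.Propositional using (_∈_)
open import Relation.Nullary using (yes; no)
open import Relation.Binary.PropositionalEquality using (_≡_)
import Data.Nat as N

-- A dyadic segment of level s starting at a: the interval [a , a + 2^s].
record Segment : Set where
  constructor seg
  field
    level : ℕ
    start : ℕ

open Segment public

segEnd : Segment → ℕ
segEnd S = start S + 2 ^ level S

_⊆I_ : ℕ × ℕ → Segment → Set
(x , y) ⊆I S = start S ≤ x × y ≤ segEnd S

_⊆S_ : Segment → Segment → Set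
S ⊆S S' = (start S , segEnd S) ⊆I S'

-- The loop of the paper: current level s, current time t, horizon T.
-- The fuel bounds the number of iterations; the loop stops when t = T.
segLoop : (T fuel s t : ℕ) → List Segment
segLoop T zero s t = []
segLoop T (suc k) s t with t N.≟ T
... | yes _ = []
... | no _ with 2 ^ (suc s) ∣? t
...   | yes _ = seg s t ∷ seg s (t + 2 ^ s) ∷ segLoop T k (suc s) (t + 2 ^ suc s)
...   | no _  = seg s t ∷ segLoop T k (suc s) (t + 2 ^ s)

-- Seg for a job with release date r, T = 2^ℓ  (ℓ+1 iterations suffice)
Seg : (ℓ r : ℕ) → List Segment
Seg ℓ r = segLoop (2 ^ ℓ) (suc ℓ) 0 r

-- Jobs are Fin n, numbered in the order ≺_J; r is the release-date function.
JobSeg : ℕ → Set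
JobSeg n = Fin n × Segment

Parent : (ℓ n : ℕ) (r : Fin n → ℕ) → JobSeg n → JobSeg n → Set
Parent ℓ n r (j' , S') (j , S) =
  suc (toℕ j') ≡ toℕ j × S' ∈ Seg ℓ (r j') × S ∈ Seg ℓ (r j) × S ⊆S S'

InV : (ℓ n : ℕ) (r : Fin n → ℕ) (s t : ℕ) → JobSeg n → Set
InV ℓ n r s t (j , S) =
  S ∈ Seg ℓ (r j) × s ≤ r j × r j ≤ t × (t , suc t) ⊆I S

module Submission where

-- Each Seg(j) consists of aligned dyadic segments (2 ^ level divides start) tiling [r_j , T), and
-- the level of the segment of Seg(j) covering a unit interval [x , x + 1] does not increase
-- with r_j. Two aligned segments covering the same point are nested, so the covering segments
-- of consecutive jobs are in the parent relation. The jobs having a segment in V_I are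
-- consecutive in ≺_J: a covering segment of a later job shows t < T, and then every earlier
-- job released in [s , t] has a covering segment as well.

open import Defs
open import Data.Nat using (ℕ; zero; suc; _+_; _*_; _∸_; _^_; _≤_; _<_; z≤n; s≤s; z<s; _≟_; _≤?_; _<?_; >-nonZero)
open import Data.Nat.Properties
open import Data.Nat.Divisibility using (_∣_; divides; _∣?_; ∣-trans; ∣-refl; ∣m∣n⇒∣m+n; ∣⇒≤; 1∣_; m∣m*n)
open import Data.Nat.Tactic.RingSolver using (solve-∀)
open import Data.Fin using (Fin; toℕ; inject₁)
open import Data.Fin.Properties using (toℕ-inject₁)
import Data.Fin as F
open import Data.Product using (_×_; _,_; Σ; ∃-syntax; proj₁; proj₂)
open import Data.Sum using (_⊎_; inj₁; inj₂)
open import Data.List using (List; []; _∷_; _++_; tabulate; allFin)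
open import Data.List.Membership.Propositional using (_∈_; find; lose)
open import Data.List.Membership.Propositional.Properties using (∈-++⁻; ∈-++⁺ˡ; ∈-++⁺ʳ; ∈-allFin)
open import Data.List.Relation.Unary.Any using (here; there; any?)
open import Data.List.Relation.Unary.Linked using (Linked; []; [-]; _∷_)
import Data.List.Relation.Unary.Linked as Linked
open import Relation.Binary using (Rel)
open import Relation.Nullary using (¬_; yes; no; Dec; contradiction)
open import Relation.Nullary.Decidable using (_×-dec_; map′)
open import Relation.Binary.PropositionalEquality
open import Function.Base using (_∘_; id)
open import Function.Bundles using (_⇔_; mk⇔)

-- Multiples

multiples-apart : ∀ {q a b} → q ∣ a → q ∣ b → a < b → a + q ≤ b
multiples-apart {q} (divides u refl) (divides v refl) u*q<v*q =
  subst (_≤ v * q) (+-comm q (u * q)) (*-monoˡ-≤ q (*-cancelʳ-< q u v u*q<v*q))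

no-multiple-between : ∀ {q a b} → q ∣ a → q ∣ b → b < a + q → b ≤ a
no-multiple-between q∣a q∣b b<a+q = ≮⇒≥ (λ a<b → <⇒≱ b<a+q (multiples-apart q∣a q∣b a<b))

^-∣-^ : ∀ m {a b} → a ≤ b → m ^ a ∣ m ^ b
^-∣-^ m {a} {b} a≤b =
  subst (m ^ a ∣_) (trans (sym (^-distribˡ-+-* m a (b ∸ a))) (cong (m ^_) (m+[n∸m]≡n a≤b))) (m∣m*n _)

even⊎odd : ∀ u → (∃[ v ] u ≡ v + v) ⊎ (∃[ v ] u ≡ suc (v + v))
even⊎odd zero = inj₁ (0 , refl)
even⊎odd (suc u) with even⊎odd u
... | inj₁ (v , refl) = inj₂ (v , refl)
... | inj₂ (v , refl) = inj₁ (suc v , cong suc (sym (+-suc v v)))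

odd-multiple-next : ∀ {q t} → q ∣ t → ¬ (2 * q ∣ t) → 2 * q ∣ t + q
odd-multiple-next {q} (divides u refl) ∤ with even⊎odd u
... | inj₁ (v , refl) = contradiction (divides v (even v q)) ∤
  where
  even : ∀ v q → (v + v) * q ≡ v * (2 * q)
  even = solve-∀
... | inj₂ (v , refl) = divides (suc v) (odd v q)
  where
  odd : ∀ v q → suc (v + v) * q + q ≡ suc v * (2 * q)
  odd = solve-∀

record NextMultiple (q t m : ℕ) : Set where
  field
    above    : t < m
    multiple : q ∣ m
    least    : ∀ {m′} → t < m′ → q ∣ m′ → m ≤ m′

next-multiple-of-multiple : ∀ {q t} → 0 < q → q ∣ t → NextMultiple q t (t + q)
next-multiple-of-multiple q>0 q∣t = record
  { above    = m<m+n _ q>0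
  ; multiple = ∣m∣n⇒∣m+n q∣t ∣-refl
  ; least    = λ t<m′ q∣m′ → multiples-apart q∣t q∣m′ t<m′
  }

next-multiple-of-odd : ∀ {q t} → 0 < q → q ∣ t → ¬ (2 * q ∣ t) → NextMultiple (2 * q) t (t + q)
next-multiple-of-odd {q} q>0 q∣t ∤ = record
  { above    = m<m+n _ q>0
  ; multiple = odd-multiple-next q∣t ∤
  ; least    = λ t<m′ 2q∣m′ → multiples-apart q∣t (∣-trans (divides 2 refl) 2q∣m′) t<m′
  }

-- Aligned dyadic segments

Covers : ℕ → Segment → Set
Covers x S = (x , suc x) ⊆I S

Aligned : Segment → Set
Aligned S = 2 ^ level S ∣ start S

aligned-covering-⊆ : ∀ {x S S′} → Aligned S → Aligned S′ → Covers x S → Covers x S′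
                   → level S′ ≤ level S → S′ ⊆S S
aligned-covering-⊆ {x} {S} {S′} aS aS′ (S≤x , x<S) (S′≤x , x<S′) l′≤l =
  no-multiple-between aS′ q∣S (≤-<-trans S≤x x<S′) ,
  no-multiple-between (∣m∣n⇒∣m+n q∣S q∣2ˡ) (∣m∣n⇒∣m+n aS′ ∣-refl) (+-monoˡ-< q (≤-<-trans S′≤x x<S))
  where
  q : ℕ
  q = 2 ^ level S′
  q∣2ˡ : q ∣ 2 ^ level S
  q∣2ˡ = ^-∣-^ 2 l′≤l
  q∣S : q ∣ start S
  q∣S = ∣-trans q∣2ˡ aS

aligned-covering-≡ : ∀ {x S S′} → Aligned S → Aligned S′ → Covers x S → Covers x S′
                   → level S ≡ level S′ → S ≡ S′
aligned-covering-≡ aS aS′ cS cS′ l≡l′ = cong₂ seg l≡l′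
  (≤-antisym (proj₁ (aligned-covering-⊆ aS aS′ cS cS′ (≤-reflexive (sym l≡l′))))
             (proj₁ (aligned-covering-⊆ aS′ aS cS′ cS (≤-reflexive l≡l′))))

-- The segment loop

record Emitted (s t : ℕ) (S : Segment) : Set where
  field
    start-≥ : t ≤ start S
    level-≥ : s ≤ level S
    aligned : Aligned S

open NextMultiple
open Emitted

module Loop (T : ℕ) where

  halted : ∀ {k s t} → t ≡ T → segLoop T (suc k) s t ≡ []
  halted {t = t} t≡T with t ≟ T
  ... | yes _   = refl
  ... | no t≢T = contradiction t≡T t≢T

  running : ∀ {k s t S} → S ∈ segLoop T (suc k) s t → t ≢ T
  running S∈ t≡T with subst (_ ∈_) (halted t≡T) S∈
  ... | ()

  unfold-even : ∀ {k s t} → t ≢ T → 2 ^ suc s ∣ t →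
    segLoop T (suc k) s t ≡ seg s t ∷ seg s (t + 2 ^ s) ∷ segLoop T k (suc s) (t + 2 ^ suc s)
  unfold-even {s = s} {t} t≢T 2q∣t with t ≟ T
  ... | yes t≡T = contradiction t≡T t≢T
  ... | no _ with 2 ^ suc s ∣? t
  ...   | yes _ = refl
  ...   | no ∤  = contradiction 2q∣t ∤

  unfold-odd : ∀ {k s t} → t ≢ T → ¬ (2 ^ suc s ∣ t) →
    segLoop T (suc k) s t ≡ seg s t ∷ segLoop T k (suc s) (t + 2 ^ s)
  unfold-odd {s = s} {t} t≢T ∤ with t ≟ T
  ... | yes t≡T = contradiction t≡T t≢T
  ... | no _ with 2 ^ suc s ∣? t
  ...   | yes 2q∣t = contradiction 2q∣t ∤
  ...   | no _     = refl

  record Step (k s t : ℕ) : Set where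
    field
      next         : ℕ
      heads        : List Segment
      unfold       : segLoop T (suc k) s t ≡ heads ++ segLoop T k (suc s) next
      next-least   : NextMultiple (2 ^ suc s) t next
      head-level   : ∀ {h} → h ∈ heads → level h ≡ s
      head-aligned : ∀ {h} → h ∈ heads → Aligned h
      head-start   : ∀ {h} → h ∈ heads → t ≤ start h
      head-end     : ∀ {h} → h ∈ heads → segEnd h ≤ next
      heads-cover  : ∀ {x} → t ≤ x → x < next → ∃[ h ] h ∈ heads × Covers x h

    split : ∀ {S} → S ∈ segLoop T (suc k) s t → S ∈ heads ⊎ S ∈ segLoop T k (suc s) next
    split S∈ = ∈-++⁻ heads (subst (_ ∈_) unfold S∈)

    from-heads : ∀ {S} → S ∈ heads → S ∈ segLoop T (suc k) s t
    from-heads S∈ = subst (_ ∈_) (sym unfold) (∈-++⁺ˡ S∈)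

    from-rest : ∀ {S} → S ∈ segLoop T k (suc s) next → S ∈ segLoop T (suc k) s t
    from-rest S∈ = subst (_ ∈_) (sym unfold) (∈-++⁺ʳ heads S∈)

  open Step

  step-even : ∀ {k s t} → t ≢ T → 2 ^ suc s ∣ t → Step k s t
  step-even {k} {s} {t} t≢T 2q∣t = record
    { next         = t + 2 ^ suc s
    ; heads        = seg s t ∷ seg s (t + q) ∷ []
    ; unfold       = unfold-even t≢T 2q∣t
    ; next-least   = next-multiple-of-multiple (m^n>0 2 (suc s)) 2q∣t
    ; head-level   = λ { (here refl) → refl ; (there (here refl)) → refl ; (there (there ())) }
    ; head-aligned = λ { (here refl) → q∣t ; (there (here refl)) → ∣m∣n⇒∣m+n q∣t ∣-refl
                       ; (there (there ())) }
    ; head-start   = λ { (here refl) → ≤-refl ; (there (here refl)) → m≤m+n t q ; (there (there ())) }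
    ; head-end     = λ { (here refl) → +-monoʳ-≤ t (m≤m+n q _) ; (there (here refl)) → ≤-reflexive t+q+q
                       ; (there (there ())) }
    ; heads-cover  = cover
    }
    where
    q : ℕ
    q = 2 ^ s
    q∣t : q ∣ t
    q∣t = ∣-trans (divides 2 refl) 2q∣t
    t+q+q : t + q + q ≡ t + 2 ^ suc s
    t+q+q = trans (+-assoc t q q) (cong (λ z → t + (q + z)) (sym (+-identityʳ q)))
    cover : ∀ {x} → t ≤ x → x < t + 2 ^ suc s → ∃[ h ] h ∈ seg s t ∷ seg s (t + q) ∷ [] × Covers x h
    cover {x} t≤x x<next with x <? t + q
    ... | yes x<t+q = seg s t , here refl , t≤x , x<t+q
    ... | no x≮t+q  = seg s (t + q) , there (here refl) , ≮⇒≥ x≮t+q , subst (x <_) (sym t+q+q) x<next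

  step-odd : ∀ {k s t} → t ≢ T → 2 ^ s ∣ t → ¬ (2 ^ suc s ∣ t) → Step k s t
  step-odd {k} {s} {t} t≢T q∣t ∤ = record
    { next         = t + 2 ^ s
    ; heads        = seg s t ∷ []
    ; unfold       = unfold-odd t≢T ∤
    ; next-least   = next-multiple-of-odd (m^n>0 2 s) q∣t ∤
    ; head-level   = λ { (here refl) → refl ; (there ()) }
    ; head-aligned = λ { (here refl) → q∣t ; (there ()) }
    ; head-start   = λ { (here refl) → ≤-refl ; (there ()) }
    ; head-end     = λ { (here refl) → ≤-refl ; (there ()) }
    ; heads-cover  = λ t≤x x<next → seg s t , here refl , t≤x , x<next
    }

  step : ∀ {k s t} → t ≢ T → 2 ^ s ∣ t → Step k s t
  step {s = s} {t} t≢T q∣t with 2 ^ suc s ∣? t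
  ... | yes 2q∣t = step-even t≢T 2q∣t
  ... | no ∤     = step-odd t≢T q∣t ∤

  emitted : ∀ k {s t S} → 2 ^ s ∣ t → S ∈ segLoop T k s t → Emitted s t S
  emitted (suc k) {s} {t} {S} q∣t S∈ = by-cases (split st S∈)
    where
    st : Step k s t
    st = step (running S∈) q∣t
    by-cases : S ∈ heads st ⊎ S ∈ segLoop T k (suc s) (next st) → Emitted s t S
    by-cases (inj₁ h∈) = record
      { start-≥ = head-start st h∈ ; level-≥ = ≤-reflexive (sym (head-level st h∈)) ; aligned = head-aligned st h∈ }
    by-cases (inj₂ r∈) = record
      { start-≥ = ≤-trans (<⇒≤ (above (next-least st))) (start-≥ e)
      ; level-≥ = ≤-trans (n≤1+n s) (level-≥ e)
      ; aligned = aligned e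
      }
      where
      e : Emitted (suc s) (next st) S
      e = emitted k (multiple (next-least st)) r∈

  covering-level-antitone : ∀ k {s t t′ x S S′} → 2 ^ s ∣ t → 2 ^ s ∣ t′ → t ≤ t′
    → S ∈ segLoop T k s t → S′ ∈ segLoop T k s t′ → Covers x S → Covers x S′ → level S′ ≤ level S
  covering-level-antitone (suc k) {s} {t} {t′} {x} {S} {S′} q∣t q∣t′ t≤t′ S∈ S′∈ cS cS′ =
    by-cases (split st S∈) (split st′ S′∈)
    where
    st : Step k s t
    st = step (running S∈) q∣t
    st′ : Step k s t′
    st′ = step (running S′∈) q∣t′
    next≤next′ : next st ≤ next st′
    next≤next′ = least (next-least st) (≤-<-trans t≤t′ (above (next-least st′))) (multiple (next-least st′))
    by-cases : S ∈ heads st ⊎ S ∈ segLoop T k (suc s) (next st)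
             → S′ ∈ heads st′ ⊎ S′ ∈ segLoop T k (suc s) (next st′) → level S′ ≤ level S
    by-cases _ (inj₁ h′∈) = ≤-trans (≤-reflexive (head-level st′ h′∈)) (level-≥ (emitted (suc k) q∣t S∈))
    by-cases (inj₁ h∈) (inj₂ r′∈) = contradiction
      (≤-trans (start-≥ (emitted k (multiple (next-least st′)) r′∈)) (proj₁ cS′))
      (<⇒≱ (<-≤-trans (proj₂ cS) (≤-trans (head-end st h∈) next≤next′)))
    by-cases (inj₂ r∈) (inj₂ r′∈) =
      covering-level-antitone k (multiple (next-least st)) (multiple (next-least st′)) next≤next′ r∈ r′∈ cS cS′

  covering-unique : ∀ k {s t x S S′} → 2 ^ s ∣ t
    → S ∈ segLoop T k s t → S′ ∈ segLoop T k s t → Covers x S → Covers x S′ → S ≡ S′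
  covering-unique k q∣t S∈ S′∈ cS cS′ =
    aligned-covering-≡ (aligned (emitted k q∣t S∈)) (aligned (emitted k q∣t S′∈)) cS cS′
      (≤-antisym (covering-level-antitone k q∣t q∣t ≤-refl S′∈ S∈ cS′ cS)
                 (covering-level-antitone k q∣t q∣t ≤-refl S∈ S′∈ cS cS′))

-- Segments of a job

module Dyadic (ℓ : ℕ) where

  T : ℕ
  T = 2 ^ ℓ

  open Loop T
  open Step

  record Reachable (k s t : ℕ) : Set where
    field
      fuel         : k + s ≡ suc ℓ
      time-aligned : 2 ^ s ∣ t
      level≤time   : s ≤ t

  open Reachable

  reachable-start : ∀ r → Reachable (suc ℓ) 0 r
  reachable-start r = record { fuel = +-identityʳ (suc ℓ) ; time-aligned = 1∣ r ; level≤time = z≤n }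

  reachable-next : ∀ {k s t} → Reachable (suc k) s t → (st : Step k s t) → Reachable k (suc s) (next st)
  reachable-next {k} {s} R st = record
    { fuel         = trans (+-suc k s) (fuel R)
    ; time-aligned = multiple (next-least st)
    ; level≤time   = ≤-<-trans (level≤time R) (above (next-least st))
    }

  reachable-time-≥ : ∀ {k s t} → Reachable k s t → 0 < s → 2 ^ s ≤ t
  reachable-time-≥ R 0<s = ∣⇒≤ {{>-nonZero (<-≤-trans 0<s (level≤time R))}} (time-aligned R)

  covers : ∀ k {s t x} → Reachable k s t → t ≤ x → x < T → ∃[ S ] S ∈ segLoop T k s t × Covers x S
  covers zero {t = t} {x} R t≤x x<T = contradiction x<T (≤⇒≯ (begin
    2 ^ ℓ       ≤⟨ ^-monoʳ-≤ 2 (n≤1+n ℓ) ⟩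
    2 ^ suc ℓ   ≡⟨ cong (2 ^_) (sym (fuel R)) ⟩
    _           ≤⟨ reachable-time-≥ R (subst (0 <_) (sym (fuel R)) z<s) ⟩
    t           ≤⟨ t≤x ⟩
    x           ∎))
    where open ≤-Reasoning
  covers (suc k) {s} {t} {x} R t≤x x<T = via (step t≢T (time-aligned R))
    where
    t≢T : t ≢ T
    t≢T t≡T = <⇒≱ x<T (subst (_≤ x) t≡T t≤x)
    via : Step k s t → ∃[ S ] S ∈ segLoop T (suc k) s t × Covers x S
    via st with x <? next st
    ... | yes x<next = let h , h∈ , c = heads-cover st t≤x x<next in h , from-heads st h∈ , c
    ... | no x≮next  = let S , S∈ , c = covers k (reachable-next R st) (≮⇒≥ x≮next) x<T in S , from-rest st S∈ , c

  -- For ℓ = 0 the loop starts at t = 0 = T ∸ 1, which is even, so it also emits [1 , 2] beyond T.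
  next-≤-T : ∀ {k s t m} → 0 < ℓ → Reachable (suc k) s t → t < T → NextMultiple (2 ^ suc s) t m → m ≤ T
  next-≤-T {zero} {s} {t} 0<ℓ R t<T _ =
    contradiction (subst (λ e → 2 ^ e ≤ t) s≡ℓ (reachable-time-≥ R (subst (0 <_) (sym s≡ℓ) 0<ℓ))) (<⇒≱ t<T)
    where
    s≡ℓ : s ≡ ℓ
    s≡ℓ = suc-injective (fuel R)
  next-≤-T {suc k} {s} 0<ℓ R t<T nm =
    least nm t<T (^-∣-^ 2 (≤-trans (s≤s (m≤n+m s k)) (≤-reflexive (suc-injective (fuel R)))))

  segEnd-≤-T : ∀ k {s t S} → 0 < ℓ → Reachable k s t → t ≤ T → S ∈ segLoop T k s t → segEnd S ≤ T
  segEnd-≤-T (suc k) {s} {t} {S} 0<ℓ R t≤T S∈ = by-cases (split st S∈)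
    where
    st : Step k s t
    st = step (running S∈) (time-aligned R)
    next≤T : next st ≤ T
    next≤T = next-≤-T 0<ℓ R (≤∧≢⇒< t≤T (running S∈)) (next-least st)
    by-cases : S ∈ heads st ⊎ S ∈ segLoop T k (suc s) (next st) → segEnd S ≤ T
    by-cases (inj₁ h∈) = ≤-trans (head-end st h∈) next≤T
    by-cases (inj₂ r∈) = segEnd-≤-T k 0<ℓ (reachable-next R st) next≤T r∈

  Seg-covers : ∀ {r x} → r ≤ x → x < T → ∃[ S ] S ∈ Seg ℓ r × Covers x S
  Seg-covers {r} = covers (suc ℓ) (reachable-start r)

  Seg-segEnd-≤ : ∀ {r S} → 0 < ℓ → r ≤ T → S ∈ Seg ℓ r → segEnd S ≤ T
  Seg-segEnd-≤ {r} 0<ℓ = segEnd-≤-T (suc ℓ) 0<ℓ (reachable-start r)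

  Seg-covering-unique : ∀ {r x S S′} → S ∈ Seg ℓ r → S′ ∈ Seg ℓ r → Covers x S → Covers x S′ → S ≡ S′
  Seg-covering-unique {r} = covering-unique (suc ℓ) {t = r} (1∣ r)

  Seg-covering-⊆ : ∀ {r r′ x S S′} → r ≤ r′
    → S ∈ Seg ℓ r → S′ ∈ Seg ℓ r′ → Covers x S → Covers x S′ → S′ ⊆S S
  Seg-covering-⊆ {r} {r′} r≤r′ S∈ S′∈ cS cS′ =
    aligned-covering-⊆ (aligned (emitted (suc ℓ) (1∣ r) S∈)) (aligned (emitted (suc ℓ) (1∣ r′) S′∈)) cS cS′
      (covering-level-antitone (suc ℓ) (1∣ r) (1∣ r′) r≤r′ S∈ S′∈ cS cS′)

Seg-covering-transfer : ∀ ℓ {r r′ x S′} → r < 2 ^ ℓ → r′ < 2 ^ ℓ → r ≤ x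
  → S′ ∈ Seg ℓ r′ → Covers x S′ → ∃[ S ] S ∈ Seg ℓ r × Covers x S
Seg-covering-transfer zero r<1 r′<1 _ S′∈ cS′ =
  _ , subst (λ z → _ ∈ Seg 0 z) (trans (n<1⇒n≡0 r′<1) (sym (n<1⇒n≡0 r<1))) S′∈ , cS′
Seg-covering-transfer (suc ℓ) r<T r′<T r≤x S′∈ cS′ =
  Seg-covers r≤x (<-≤-trans (proj₂ cS′) (Seg-segEnd-≤ z<s (<⇒≤ r′<T) S′∈))
  where open Dyadic (suc ℓ)

-- Jobs in release order

Consecutive : ∀ {n} → Rel (Fin n) _
Consecutive i j = suc (toℕ i) ≡ toℕ j

tabulate-linked : ∀ {a ρ} {A : Set a} {R : Rel A ρ} {n} {f : Fin (suc n) → A}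
  → (∀ i → R (f (inject₁ i)) (f (F.suc i))) → Linked R (tabulate f)
tabulate-linked {n = zero}  _      = [-]
tabulate-linked {n = suc n} {f} R-step = R-step F.zero ∷ tabulate-linked {f = f ∘ F.suc} (R-step ∘ F.suc)

allFin-consecutive : ∀ n → Linked Consecutive (allFin n)
allFin-consecutive zero    = []
allFin-consecutive (suc n) = tabulate-linked {f = id} (λ i → cong suc (toℕ-inject₁ i))

consecutive-increasing : ∀ {n} {i j : Fin n} {js} → Linked Consecutive (i ∷ js) → j ∈ js → toℕ i < toℕ j
consecutive-increasing (i→j ∷ _)   (here refl) = ≤-reflexive i→j
consecutive-increasing (i→k ∷ ks) (there j∈) = <-trans (≤-reflexive i→k) (consecutive-increasing ks j∈)

module Jobs (ℓ n : ℕ) (r : Fin n → ℕ) (r<T : ∀ j → r j < 2 ^ ℓ) (r-mono : ∀ i j → i F.≤ j → r i ≤ r j)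
            (lo hi : ℕ) where

  open Dyadic ℓ using (Seg-covering-unique; Seg-covering-⊆)

  Vertex : JobSeg n → Set
  Vertex = InV ℓ n r lo hi

  HasVertex : Fin n → Set
  HasVertex j = ∃[ S ] Vertex (j , S)

  hasVertex? : ∀ j → Dec (HasVertex j)
  hasVertex? j = map′ find (λ (_ , S∈ , p) → lose S∈ p)
    (any? (λ S → lo ≤? r j ×-dec r j ≤? hi ×-dec start S ≤? hi ×-dec suc hi ≤? segEnd S) (Seg ℓ (r j)))

  vertex-unique : ∀ {j S S′} → Vertex (j , S) → Vertex (j , S′) → S ≡ S′
  vertex-unique {j} (S∈ , _ , _ , cS) (S′∈ , _ , _ , cS′) = Seg-covering-unique {r j} S∈ S′∈ cS cS′

  vertex-parent : ∀ {i j S S′} → Consecutive i j → Vertex (i , S) → Vertex (j , S′) → Parent ℓ n r (i , S) (j , S′)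
  vertex-parent {i} {j} i→j (S∈ , _ , _ , cS) (S′∈ , _ , _ , cS′) =
    i→j , S∈ , S′∈ , Seg-covering-⊆ {r i} {r j} (r-mono i j (subst (toℕ i ≤_) i→j (n≤1+n _))) S∈ S′∈ cS cS′

  hasVertex-convex : ∀ {i j k} → toℕ i < toℕ j → toℕ j < toℕ k → HasVertex i → HasVertex k → HasVertex j
  hasVertex-convex {i} {j} {k} i<j j<k (_ , _ , lo≤ri , _) (_ , S∈ , _ , rk≤hi , cS) =
    let S′ , S′∈ , cS′ = Seg-covering-transfer ℓ (r<T j) (r<T k) rj≤hi S∈ cS
    in S′ , S′∈ , ≤-trans lo≤ri (r-mono i j (<⇒≤ i<j)) , rj≤hi , cS′
    where
    rj≤hi : r j ≤ hi
    rj≤hi = ≤-trans (r-mono j k (<⇒≤ j<k)) rk≤hi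

  vertices : List (Fin n) → List (JobSeg n)
  vertices [] = []
  vertices (j ∷ js) with hasVertex? j
  ... | yes (S , _) = (j , S) ∷ vertices js
  ... | no _        = vertices js

  vertices-sound : ∀ js {v} → v ∈ vertices js → Vertex v
  vertices-sound (j ∷ js) v∈ with hasVertex? j
  vertices-sound (j ∷ js) (here refl) | yes (_ , V) = V
  vertices-sound (j ∷ js) (there v∈)  | yes _       = vertices-sound js v∈
  vertices-sound (j ∷ js) v∈          | no _        = vertices-sound js v∈

  vertices-complete : ∀ {js j S} → j ∈ js → Vertex (j , S) → (j , S) ∈ vertices js
  vertices-complete {i ∷ js} j∈ V with hasVertex? i | j∈
  ... | yes (_ , V′) | here refl = here (cong (_ ,_) (vertex-unique V V′))
  ... | yes _        | there j∈′ = there (vertices-complete j∈′ V)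
  ... | no ∄         | here refl = contradiction (_ , V) ∄
  ... | no _         | there j∈′ = vertices-complete j∈′ V

  vertices-none : ∀ js → (∀ {k} → k ∈ js → ¬ HasVertex k) → vertices js ≡ []
  vertices-none [] _ = refl
  vertices-none (j ∷ js) none with hasVertex? j
  ... | yes h = contradiction h (none (here refl))
  ... | no _  = vertices-none js (none ∘ there)

  vertices-linked-from : ∀ {i S js} → Linked Consecutive (i ∷ js) → Vertex (i , S)
    → Linked (Parent ℓ n r) ((i , S) ∷ vertices js)
  vertices-linked-from {js = []} _ _ = [-]
  vertices-linked-from {i} {S} {j ∷ js} (i→j ∷ j-js) V with hasVertex? j
  ... | yes (S′ , V′) = vertex-parent i→j V V′ ∷ vertices-linked-from j-js V′
  ... | no ∄ = subst (λ vs → Linked (Parent ℓ n r) ((i , S) ∷ vs)) (sym (vertices-none js none)) [-]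
    where
    none : ∀ {k} → k ∈ js → ¬ HasVertex k
    none k∈ hk = ∄ (hasVertex-convex (≤-reflexive i→j) (consecutive-increasing j-js k∈) (S , V) hk)

  vertices-linked : ∀ {js} → Linked Consecutive js → Linked (Parent ℓ n r) (vertices js)
  vertices-linked {[]} _ = []
  vertices-linked {j ∷ js} js-linked with hasVertex? j
  ... | yes (_ , V) = vertices-linked-from js-linked V
  ... | no _        = vertices-linked (Linked.tail js-linked)

lemma3 : (ℓ n : ℕ) (r : Fin n → ℕ)
    → (∀ j → r j < 2 ^ ℓ)
    → (∀ i j → i F.≤ j → r i ≤ r j)
    → (s t : ℕ) → s ≤ t → t ≤ 2 ^ ℓ
    → Σ (List (JobSeg n)) λ vs →
        Linked (Parent ℓ n r) vs × (∀ v → (v ∈ vs) ⇔ InV ℓ n r s t v)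
lemma3 ℓ n r r<T r-mono s t _ _ =
  vertices (allFin n) ,
  vertices-linked (allFin-consecutive n) ,
  λ (j , S) → mk⇔ (vertices-sound (allFin n)) (vertices-complete (∈-allFin j))
  where open Jobs ℓ n r r<T r-mono s t
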